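{- Let $a\in\mathbb{Z}_{\ge1}^n$, $b\in\mathbb{Z}^n$, $w\in\mathbb{Z}_{\ge0}^n$ and $w_0\in\mathbb{Z}_{\ge0}$. If $\sum_{i\le n}w_i/a_i<w_0$, then every optimal solution $(s,x)$ of \[ \min\Big\{w_0s+\sum_{i\le n}w_ix_i : s+a_ix_i\ge b_i\ \forall i\in\{1,\dots,n\},\ s\in\mathbb{Z}_{\ge0},\ x\in\mathbb{Z}^n\Big\} \] satisfies $s<\mathrm{lcm}_{i\le n}a_i$.
   Context: $\mathrm{lcm}_{i\le n}a_i$ is the least common multiple of $a_1,\dots,a_n$. -}

module Defs where

open import Data.Nat as ℕ using (ℕ; zero; suc; NonZero)
open import Data.Nat.LCM using (lcm)
open import Data.Fin using (Fin) renaming (zero to fzero; suc to fsuc)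
open import Data.Integer as ℤ using (ℤ; +_)
open import Data.Rational as ℚ using (ℚ)
open import Data.Vec.Functional using (foldr)
open import Data.Product using (_×_)

fracSum : ∀ {n} (w a : Fin n → ℕ) → (∀ i → NonZero (a i)) → ℚ
fracSum {zero}  w a nz = ℚ.0ℚ
fracSum {suc n} w a nz =
  ((+ w fzero) ℚ./ a fzero) {{nz fzero}}
    ℚ.+ fracSum (λ i → w (fsuc i)) (λ i → a (fsuc i)) (λ i → nz (fsuc i))

lcmAll : ∀ {n} → (Fin n → ℕ) → ℕ
lcmAll a = foldr lcm 1 a

objective : ∀ {n} (w0 : ℕ) (w : Fin n → ℕ) (s : ℕ) (x : Fin n → ℤ) → ℤ
objective w0 w s x = (+ w0) ℤ.* (+ s) ℤ.+ foldr ℤ._+_ (+ 0) (λ i → (+ w i) ℤ.* x i)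

Feasible : ∀ {n} (a : Fin n → ℕ) (b : Fin n → ℤ) (s : ℕ) (x : Fin n → ℤ) → Set
Feasible a b s x = ∀ i → b i ℤ.≤ (+ s) ℤ.+ (+ a i) ℤ.* x i

Optimal : ∀ {n} (a : Fin n → ℕ) (b : Fin n → ℤ) (w : Fin n → ℕ) (w0 : ℕ)
          (s : ℕ) (x : Fin n → ℤ) → Set
Optimal a b w w0 s x =
  Feasible a b s x × (∀ s' x' → Feasible a b s' x' → objective w0 w s x ℤ.≤ objective w0 w s' x')

ℕtoℚ : ℕ → ℚ
ℕtoℚ m = (+ m) ℚ./ 1

-- If s ≥ L for a common multiple L of the a_i, replacing (s, x) by (s − L, x + c) with
-- c_i = L / a_i keeps every constraint s + a_i x_i ≥ b_i (each a_i c_i equals L) and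
-- changes the objective by Σ w_i c_i − w₀ L = L (Σ w_i / a_i − w₀) < 0, contradicting
-- optimality.
module Submission where

open import Defs
open import Data.Nat using (ℕ; NonZero; _<_)
open import Data.Fin using (Fin)
open import Data.Integer using (ℤ)
open import Data.Rational using (ℚ) renaming (_<_ to _<ℚ_)

open import Data.Nat as ℕ using (suc; _≤_; _∸_; ≢-nonZero; ≢-nonZero⁻¹)
import Data.Nat.Properties as ℕ
open import Data.Nat.Divisibility using (_∣_; ∣-trans)
open import Data.Nat.DivMod using (_/_; m/n*n≡m; m*[n/m]≡n)
open import Data.Nat.GCD using (gcd)
open import Data.Nat.LCM using (lcm; m∣lcm[m,n]; n∣lcm[m,n]; gcd*lcm)
open import Data.Integer as ℤ using (+_; _+_; _*_)
import Data.Integer.Properties as ℤ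
open import Data.Integer.Solver using (module +-*-Solver)
open import Algebra.Properties.CommutativeMonoid.Sum ℤ.+-0-commutativeMonoid
  using (sum; sum-cong-≗; ∑-distrib-+)
import Data.Rational as ℚ
import Data.Rational.Properties as ℚ
open import Data.Rational.Unnormalised as ℚᵘ using (mkℚᵘ; _≃_; *≡*; *<*)
import Data.Rational.Unnormalised.Properties as ℚᵘ
open import Data.Fin using () renaming (zero to fzero; suc to fsuc)
open import Data.Product using (_,_)
open import Relation.Binary.PropositionalEquality
open +-*-Solver using (solve; _:+_; _:*_; _:=_)

lcm-nonZero : ∀ m n .{{_ : NonZero m}} .{{_ : NonZero n}} → NonZero (lcm m n)
lcm-nonZero m n = ≢-nonZero λ lcm≡0 → ≢-nonZero⁻¹ (m ℕ.* n) {{ℕ.m*n≢0 m n}} (begin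
  m ℕ.* n                ≡⟨ gcd*lcm m n ⟨
  gcd m n ℕ.* lcm m n    ≡⟨ cong (gcd m n ℕ.*_) lcm≡0 ⟩
  gcd m n ℕ.* 0          ≡⟨ ℕ.*-zeroʳ (gcd m n) ⟩
  0                      ∎)
  where open ≡-Reasoning

lcmAll-nonZero : ∀ {n} (a : Fin n → ℕ) → (∀ i → NonZero (a i)) → NonZero (lcmAll a)
lcmAll-nonZero {ℕ.zero}  a a≢0 = _
lcmAll-nonZero {suc n} a a≢0 = lcm-nonZero (a fzero) (lcmAll (λ i → a (fsuc i)))
  {{a≢0 fzero}} {{lcmAll-nonZero (λ i → a (fsuc i)) (λ i → a≢0 (fsuc i))}}

∣lcmAll : ∀ {n} (a : Fin n → ℕ) i → a i ∣ lcmAll a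
∣lcmAll a fzero    = m∣lcm[m,n] (a fzero) _
∣lcmAll a (fsuc i) = ∣-trans (∣lcmAll (λ j → a (fsuc j)) i) (n∣lcm[m,n] (a fzero) _)

toℚᵘ-/ : ∀ i d .{{_ : NonZero d}} → ℚ.toℚᵘ (i ℚ./ d) ≃ i ℚᵘ./ d
toℚᵘ-/ i (suc d-1) = ℚ.toℚᵘ-fromℚᵘ (mkℚᵘ i d-1)

/-rescale : ∀ i d L .{{_ : NonZero d}} .{{_ : NonZero L}} → d ∣ L →
            i ℚᵘ./ d ≃ (i * + (L / d)) ℚᵘ./ L
/-rescale i d@(suc _) L@(suc _) d∣L = *≡* (begin
  i * + L                   ≡⟨ cong (λ k → i * + k) (m/n*n≡m d∣L) ⟨
  i * + (L / d ℕ.* d)       ≡⟨ cong (i *_) (ℤ.pos-* (L / d) d) ⟩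
  i * (+ (L / d) * + d)     ≡⟨ ℤ.*-assoc i (+ (L / d)) (+ d) ⟨
  i * + (L / d) * + d       ∎)
  where open ≡-Reasoning

/-distrib-+ : ∀ i j d .{{_ : NonZero d}} → i ℚᵘ./ d ℚᵘ.+ j ℚᵘ./ d ≃ (i + j) ℚᵘ./ d
/-distrib-+ i j d@(suc _) = *≡* (solve 3
  (λ i j d → (i :* d :+ j :* d) :* d := (i :+ j) :* (d :* d)) refl i j (+ d))

fracSum≃ : ∀ {n} (w a : Fin n → ℕ) (a≢0 : ∀ i → NonZero (a i)) L .{{_ : NonZero L}} →
           (∀ i → a i ∣ L) →
           ℚ.toℚᵘ (fracSum w a a≢0) ≃ sum (λ i → + w i * + ((L / a i) {{a≢0 i}})) ℚᵘ./ L
fracSum≃ {ℕ.zero} w a a≢0 L@(suc _) a∣L = *≡* refl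
fracSum≃ {suc n} w a a≢0 L a∣L = begin-equality
  ℚ.toℚᵘ (head ℚ.+ tail)
    ≃⟨ ℚ.toℚᵘ-homo-+ head tail ⟩
  ℚ.toℚᵘ head ℚᵘ.+ ℚ.toℚᵘ tail
    ≃⟨ ℚᵘ.+-cong (ℚᵘ.≃-trans (toℚᵘ-/ (+ w fzero) (a fzero))
                             (/-rescale (+ w fzero) (a fzero) L (a∣L fzero)))
                 (fracSum≃ (λ i → w (fsuc i)) (λ i → a (fsuc i)) (λ i → a≢0 (fsuc i))
                           L (λ i → a∣L (fsuc i))) ⟩
  (+ w fzero * + c fzero) ℚᵘ./ L ℚᵘ.+ sum (λ i → + w (fsuc i) * + c (fsuc i)) ℚᵘ./ L
    ≃⟨ /-distrib-+ _ _ L ⟩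
  sum (λ i → + w i * + c i) ℚᵘ./ L ∎
  where
  open ℚᵘ.≤-Reasoning
  instance
    a₀≢0 : NonZero (a fzero)
    a₀≢0 = a≢0 fzero
  c : Fin (suc n) → ℕ
  c i = (L / a i) {{a≢0 i}}
  head tail : ℚ
  head = (+ w fzero) ℚ./ a fzero
  tail = fracSum (λ i → w (fsuc i)) (λ i → a (fsuc i)) (λ i → a≢0 (fsuc i))

weightedQuotients<w₀L : ∀ {n} (w a : Fin n → ℕ) (a≢0 : ∀ i → NonZero (a i)) w₀ →
                        fracSum w a a≢0 <ℚ ℕtoℚ w₀ → ∀ L .{{_ : NonZero L}} → (∀ i → a i ∣ L) →
                        sum (λ i → + w i * + ((L / a i) {{a≢0 i}})) ℤ.< + w₀ * + L
weightedQuotients<w₀L w a a≢0 w₀ lt L@(suc _) a∣L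
  with ℚᵘ.<-respʳ-≃ (toℚᵘ-/ (+ w₀) 1) (ℚᵘ.<-respˡ-≃ (fracSum≃ w a a≢0 L a∣L) (ℚ.toℚᵘ-mono-< lt))
... | *<* S*1<w₀*L = subst (ℤ._< + w₀ * + L) (ℤ.*-identityʳ _) S*1<w₀*L

+[m∸n]+n≡m : ∀ {m n} → n ≤ m → + (m ∸ n) + + n ≡ + m
+[m∸n]+n≡m {m} {n} n≤m = trans (sym (ℤ.pos-+ (m ∸ n) n)) (cong +_ (ℕ.m∸n+n≡m n≤m))

Feasible-shift : ∀ {n} (a : Fin n → ℕ) b s x L (c : Fin n → ℕ) → L ≤ s →
                 (∀ i → a i ℕ.* c i ≡ L) →
                 Feasible a b s x → Feasible a b (s ∸ L) (λ i → x i + + c i)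
Feasible-shift a b s x L c L≤s a*c≡L feasible i = subst (b i ℤ.≤_) (sym (begin
  + (s ∸ L) + + a i * (x i + + c i)      ≡⟨ solve 4 (λ s' a x c → s' :+ a :* (x :+ c) := s' :+ a :* c :+ a :* x)
                                                 refl (+ (s ∸ L)) (+ a i) (x i) (+ c i) ⟩
  + (s ∸ L) + + a i * + c i + + a i * x i ≡⟨ cong (λ t → + (s ∸ L) + t + + a i * x i)
                                                 (trans (sym (ℤ.pos-* (a i) (c i))) (cong +_ (a*c≡L i))) ⟩
  + (s ∸ L) + + L + + a i * x i           ≡⟨ cong (_+ + a i * x i) (+[m∸n]+n≡m L≤s) ⟩
  + s + + a i * x i                       ∎)) (feasible i)
  where open ≡-Reasoning

objective-shift : ∀ {n} w₀ (w : Fin n → ℕ) s x L (c : Fin n → ℕ) → L ≤ s →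
                  objective w₀ w (s ∸ L) (λ i → x i + + c i) + + w₀ * + L
                    ≡ objective w₀ w s x + sum (λ i → + w i * + c i)
objective-shift w₀ w s x L c L≤s = begin
  + w₀ * + (s ∸ L) + sum (λ i → + w i * (x i + + c i)) + + w₀ * + L
    ≡⟨ cong (λ t → + w₀ * + (s ∸ L) + t + + w₀ * + L) (trans
         (sum-cong-≗ (λ i → ℤ.*-distribˡ-+ (+ w i) (x i) (+ c i)))
         (∑-distrib-+ (λ i → + w i * x i) (λ i → + w i * + c i))) ⟩
  + w₀ * + (s ∸ L) + (Σwx + Σwc) + + w₀ * + L
    ≡⟨ solve 5 (λ w₀ s' L p q → w₀ :* s' :+ (p :+ q) :+ w₀ :* L := w₀ :* (s' :+ L) :+ p :+ q)
         refl (+ w₀) (+ (s ∸ L)) (+ L) Σwx Σwc ⟩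
  + w₀ * (+ (s ∸ L) + + L) + Σwx + Σwc
    ≡⟨ cong (λ t → + w₀ * t + Σwx + Σwc) (+[m∸n]+n≡m L≤s) ⟩
  + w₀ * + s + Σwx + Σwc ∎
  where
  open ≡-Reasoning
  Σwx Σwc : ℤ
  Σwx = sum (λ i → + w i * x i)
  Σwc = sum (λ i → + w i * + c i)

Optimal⇒s<commonMultiple : ∀ {n} (a : Fin n → ℕ) (a≢0 : ∀ i → NonZero (a i)) b w w₀ →
                           fracSum w a a≢0 <ℚ ℕtoℚ w₀ →
                           ∀ s x → Optimal a b w w₀ s x →
                           ∀ L .{{_ : NonZero L}} → (∀ i → a i ∣ L) → s < L
Optimal⇒s<commonMultiple {n} a a≢0 b w w₀ lt s x (feasible , minimal) L a∣L =
  ℕ.≰⇒> λ L≤s → ℤ.<-irrefl refl (shifted-cheaper L≤s)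
  where
  c : Fin n → ℕ
  c i = (L / a i) {{a≢0 i}}
  x+c : Fin n → ℤ
  x+c i = x i + + c i
  shifted-cheaper : L ≤ s → objective w₀ w (s ∸ L) x+c + + w₀ * + L
                              ℤ.< objective w₀ w (s ∸ L) x+c + + w₀ * + L
  shifted-cheaper L≤s = begin-strict
    objective w₀ w (s ∸ L) x+c + + w₀ * + L
      ≡⟨ objective-shift w₀ w s x L c L≤s ⟩
    objective w₀ w s x + sum (λ i → + w i * + c i)
      <⟨ ℤ.+-monoʳ-< (objective w₀ w s x) (weightedQuotients<w₀L w a a≢0 w₀ lt L a∣L) ⟩
    objective w₀ w s x + + w₀ * + L
      ≤⟨ ℤ.+-monoˡ-≤ (+ w₀ * + L) (minimal (s ∸ L) x+c
           (Feasible-shift a b s x L c L≤s (λ i → m*[n/m]≡n {{a≢0 i}} (a∣L i)) feasible)) ⟩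
    objective w₀ w (s ∸ L) x+c + + w₀ * + L ∎
    where open ℤ.≤-Reasoning

mainTheorem20 : (n : ℕ) (a : Fin n → ℕ) (a≥1 : ∀ i → NonZero (a i))
                (b : Fin n → ℤ) (w : Fin n → ℕ) (w0 : ℕ) →
                fracSum w a a≥1 <ℚ ℕtoℚ w0 →
                (s : ℕ) (x : Fin n → ℤ) → Optimal a b w w0 s x →
                s < lcmAll a
mainTheorem20 n a a≥1 b w w0 lt s x optimal =
  Optimal⇒s<commonMultiple a a≥1 b w w0 lt s x optimal (lcmAll a) {{lcmAll-nonZero a a≥1}} (∣lcmAll a)
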